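{- Let $C$ be a caterpillar with $m$ edges, let $P=(v_0,\dots,v_p)$ be a longest path in $C$, and let $\phi$ and $U_p$ be as defined in the context. Then for any $i,j$ with $1\le i\le j<p$: (1) $m-\lfloor p/2\rfloor+2\le \phi(e_i)+\phi(e_{i+1})\le m+\lceil p/2\rceil+|U_p|$; (2) if $i<j$, then $\phi(e_i)+\phi(e_{i+1})<\phi(e_j)+\phi(e_{j+1})$; (3) if $v_i$ and $v_j$ are light vertices and $i<j$, then $\phi(f_i)<\phi(f_j)$.
   Context: A caterpillar is a tree of order at least $3$ whose removal of leaves yields a path. Let $C$ have $m$ edges and let $P=(v_0,\dots,v_p)$ be a longest path in $C$; write $e_i=\{v_{i-1},v_i\}$ ($1\le i\le p$); edges not on $P$ are legs, and for a vertex $v_k$ of degree $3$ ($1\le k\le p-1$) let $f_k$ be its unique leg. The partial labeling $\phi$ is built as follows: if $p$ is odd set $\phi(e_1)=1$, $\phi(e_2)=m-\lfloor p/2\rfloor+1$; if $p$ is even set $\phi(e_1)=m-\lfloor p/2\rfloor+1$, $\phi(e_2)=1$. Set $U_1=U_2=\emptyset$. For $i=3,\dots,p$ in order: set $\phi(e_i)=\phi(e_{i-2})+1$ and $U_i=U_{i-1}$; then, if $i\equiv p\pmod 2$ and there is some $k\in\{1,\dots,i-3\}$ with $d(v_k)=3$ and $\phi(e_{i-1})=\phi(e_k)+\phi(e_{k+1})$, then for such a $k$ set $\phi(f_k)=\phi(e_{i-2})+1$, redefine $\phi(e_i)=\phi(e_{i-2})+2$, and set $U_i=U_{i-1}\cup\{v_k\}$.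 The vertices in $U_p$ are called light vertices. (The remaining legs are labeled later with labels in $[1,m]$ not used so far; this does not affect the values considered here.) -}

module Defs where

open import Data.Nat using (ℕ; zero; suc; _+_; _∸_; _≤_; _<_; _≡ᵇ_; _<ᵇ_; _%_; ⌊_/2⌋; ⌈_/2⌉)
open import Data.Nat.Properties using (_<?_; _≟_)
open import Data.Bool using (Bool; true; false; if_then_else_; _∧_)
open import Data.Fin using (Fin; fromℕ<)
open import Data.Vec using (sum; tabulate)
open import Data.List using (List; []; _∷_)
open import Data.Maybe using (Maybe; just; nothing)
open import Relation.Nullary using (yes; no)

-- Up to isomorphism, a caterpillar with a distinguished longest path
-- P = (v_0,…,v_p) is exactly determined by
--   * p ≥ 2  (order ≥ 3; a tree of order ≥ 3 has a longest path of length ≥ 2),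
--   * for each interior spine vertex v_k (1 ≤ k ≤ p-1) the number of legs
--     (pendant edges not on P) attached to v_k.
-- Since P is longest, v_0 and v_p are leaves and every non-spine vertex is a
-- leaf adjacent to an interior spine vertex.
-- The field  legs  is indexed by Fin (p ∸ 1); index k stands for v_(k+1).

record Caterpillar : Set where
  field
    p    : ℕ
    2≤p  : 2 ≤ p
    legs : Fin (p ∸ 1) → ℕ

module _ (C : Caterpillar) where
  open Caterpillar C

  edges : ℕ
  edges = p + sum (tabulate legs)

  -- degree d(v_k) of the spine vertex v_k, 0 ≤ k ≤ p
  -- (value for k > p is irrelevant; there is no such spine vertex)
  spineDeg : ℕ → ℕ
  spineDeg zero = 1
  spineDeg (suc k) with k <? (p ∸ 1)
  ... | yes k<p-1 = 2 + legs (fromℕ< k<p-1)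
  ... | no  _     = 1

  deg3 : ℕ → Bool
  deg3 k = spineDeg k ≡ᵇ 3

-- State after processing e_1, …, e_i:
--   eLab j  = φ(e_j)            (meaningful for 1 ≤ j ≤ i)
--   fLab k  = φ(f_k)            (meaningful for light v_k)
--   light   = list of indices k of the vertices v_k in U_i
record LState : Set where
  constructor mkState
  field
    eLab  : ℕ → ℕ
    fLab  : ℕ → ℕ
    light : List ℕ

upd : (ℕ → ℕ) → ℕ → ℕ → (ℕ → ℕ)
upd g i v j = if j ≡ᵇ i then v else g j

search : (ℕ → Bool) → ℕ → ℕ → Maybe ℕ
search P k zero    = nothing
search P k (suc c) = if P k then just k else search P (suc k) c

module _ (C : Caterpillar) where
  open Caterpillar C

  m : ℕ
  m = edges C

  initState : LState
  initState with p % 2 ≟ 1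
  ... | yes _ = mkState (upd (upd (λ _ → 0) 1 1) 2 (m ∸ ⌊ p /2⌋ + 1)) (λ _ → 0) []
  ... | no  _ = mkState (upd (upd (λ _ → 0) 1 (m ∸ ⌊ p /2⌋ + 1)) 2 1) (λ _ → 0) []

  step : ℕ → LState → LState
  step i (mkState e f U) with i % 2 ≟ p % 2
  ... | no _ = mkState (upd e i (e (i ∸ 2) + 1)) f U
  ... | yes _ with search (λ k → deg3 C k ∧ (e (i ∸ 1) ≡ᵇ e k + e (suc k))) 1 (i ∸ 3)
  ...   | nothing = mkState (upd e i (e (i ∸ 2) + 1)) f U
  ...   | just k  = mkState (upd e i (e (i ∸ 2) + 2)) (upd f k (e (i ∸ 2) + 1)) (k ∷ U)

  -- state after processing i = 3, …, n + 2
  run : ℕ → LState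
  run zero    = initState
  run (suc n) = step (n + 3) (run n)

  final : LState
  final = run (p ∸ 2)

  φe : ℕ → ℕ
  φe = LState.eLab final

  φf : ℕ → ℕ
  φf = LState.fLab final

  Up : List ℕ
  Up = LState.light final

module Submission where

-- The labels φ(e_i) are produced one at a time: step i sets
-- φ(e_i) = φ(e_{i-2}) + 1, or φ(e_{i-2}) + 2 when it makes a vertex light.
-- Everything follows from three facts about this process.
--   (a) Along each parity class the labels strictly increase,
--       φ(e_x) < φ(e_{x+2}); hence the pair sums
--       S(x) = φ(e_x) + φ(e_{x+1}) are strictly increasing (part (2)),
--       and labels of the same parity grow by at least one per two steps.
--   (b) The pair sum of the two newest edges equals
--       m - ⌊p/2⌋ + (number of edges so far) + (number of light vertices),
--       so S(1) = m - ⌊p/2⌋ + 2 and S(p-1) = m + ⌈p/2⌉ + |U_p|; with (a)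
--       this gives the bounds (1).
--   (c) A vertex v_k made light at the step handling e_{u+3} satisfies
--       S(k) = φ(e_{u+2}) and φ(f_k) = φ(e_{u+1}) + 1, and the step index
--       has the parity of p.  Comparing two light vertices through (a)
--       gives part (3).

open import Defs
open import Data.Nat using (ℕ; zero; suc; _+_; _∸_; _≤_; _<_; z≤n; s≤s; _%_; _≡ᵇ_; ⌊_/2⌋; ⌈_/2⌉)
open import Data.Nat.Properties
open import Data.Nat.Tactic.RingSolver using (solve-∀)
open import Data.Bool using (Bool; true; false; T; _∧_)
open import Data.Bool.Properties using (T-≡; T-∧)
open import Data.Maybe using (just; nothing)
open import Data.List using (List; []; _∷_; length)
open import Data.List.Membership.Propositional using (_∈_)
open import Data.List.Relation.Unary.Any using (here; there)
open import Data.Product using (_×_; _,_; ∃-syntax; proj₁; proj₂)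
open import Data.Sum using (_⊎_; inj₁; inj₂)
open import Data.Empty using (⊥-elim)
open import Function.Bundles using (Equivalence)
open import Relation.Nullary using (Dec; yes; no; ¬_)
open import Relation.Binary.PropositionalEquality

upd-same : ∀ g i v → upd g i v i ≡ v
upd-same g i v rewrite Equivalence.to T-≡ (≡⇒≡ᵇ i i refl) = refl

upd-other : ∀ g i v j → ¬ (j ≡ i) → upd g i v j ≡ g j
upd-other g i v j j≢i with j ≡ᵇ i in j≡ᵇi
... | true  = ⊥-elim (j≢i (≡ᵇ⇒≡ j i (Equivalence.from T-≡ j≡ᵇi)))
... | false = refl

search-sound : ∀ P k₀ c {k} → search P k₀ c ≡ just k → T (P k) × k₀ ≤ k × k < k₀ + c
search-sound P k₀ zero ()
search-sound P k₀ (suc c) found with P k₀ in Pk₀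
search-sound P k₀ (suc c) refl | true = Equivalence.from T-≡ Pk₀ , ≤-refl , m<m+n k₀ (s≤s z≤n)
... | false with search-sound P (suc k₀) c found
...   | Pk , k₀<k , k<end = Pk , <⇒≤ k₀<k , ≤-trans k<end (≤-reflexive (sym (+-suc k₀ c)))

two-more : ∀ a d → 2 + (a + (d + d)) ≡ a + (suc d + suc d)
two-more = solve-∀

parity-gap : ∀ a b → a % 2 ≡ b % 2 → a ≤ b → ∃[ d ] b ≡ a + (d + d)
parity-gap zero zero _ _ = 0 , refl
parity-gap zero (suc zero) () _
parity-gap zero (suc (suc b)) same _ with parity-gap zero b same z≤n
... | d , b≡ = suc d , trans (cong (2 +_) b≡) (two-more 0 d)
parity-gap (suc zero) (suc zero) _ _ = 0 , refl
parity-gap (suc zero) (suc (suc zero)) () _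
parity-gap (suc zero) (suc (suc (suc b))) same _ with parity-gap 1 (suc b) same (s≤s z≤n)
... | d , b≡ = suc d , trans (cong (2 +_) b≡) (two-more 1 d)
parity-gap (suc (suc a)) (suc (suc b)) same a≤b with parity-gap a b same (≤-pred (≤-pred a≤b))
... | d , b≡ = d , cong (2 +_) b≡
parity-gap (suc (suc a)) (suc zero) _ (s≤s ())

parity-gap-< : ∀ a b → a % 2 ≡ b % 2 → a < b → ∃[ d ] b ≡ a + (suc d + suc d)
parity-gap-< a b same a<b with parity-gap a b same (<⇒≤ a<b)
... | zero  , refl = ⊥-elim (<-irrefl (sym (+-identityʳ a)) a<b)
... | suc d , b≡   = d , b≡

module StrideTwo (f : ℕ → ℕ) (hi : ℕ)
                 (grow : ∀ x → 1 ≤ x → 2 + x ≤ hi → f x < f (2 + x)) where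

  stride : ∀ x d → 1 ≤ x → x + (d + d) ≤ hi → f x + d ≤ f (x + (d + d))
  stride x zero _ _ rewrite +-identityʳ x | +-identityʳ (f x) = ≤-refl
  stride x (suc d) 1≤x end≤hi = begin
      f x + suc d              ≡⟨ +-suc (f x) d ⟩
      suc (f x + d)            ≤⟨ s≤s (stride x d 1≤x (≤-trans (m≤n+m _ 2) before≤hi)) ⟩
      suc (f (x + (d + d)))    ≤⟨ grow (x + (d + d)) (≤-trans 1≤x (m≤m+n x _)) before≤hi ⟩
      f (2 + (x + (d + d)))    ≡⟨ cong f (two-more x d) ⟩
      f (x + (suc d + suc d))  ∎
    where
    open ≤-Reasoning
    before≤hi : 2 + (x + (d + d)) ≤ hi
    before≤hi = subst (_≤ hi) (sym (two-more x d)) end≤hi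

  gap-≤ : ∀ {x y d} → 1 ≤ x → y ≡ x + (d + d) → y ≤ hi → f x ≤ f y
  gap-≤ {x} {d = d} 1≤x refl y≤hi = ≤-trans (m≤m+n (f x) d) (stride x d 1≤x y≤hi)

  gap-< : ∀ {x y d} → 1 ≤ x → y ≡ x + (suc d + suc d) → y ≤ hi → f x < f y
  gap-< {x} {d = d} 1≤x refl y≤hi = <-≤-trans (m<m+n (f x) (s≤s z≤n)) (stride x (suc d) 1≤x y≤hi)

  -- S(x) = f(x) + f(x+1); one step raises it by f(x+2) - f(x) > 0.
  pairSum : ℕ → ℕ
  pairSum x = f x + f (suc x)

  pairSum-step : ∀ x → 1 ≤ x → 2 + x ≤ hi → pairSum x < pairSum (suc x)
  pairSum-step x 1≤x bound =
    subst (pairSum x <_) (+-comm (f (2 + x)) (f (suc x))) (+-monoˡ-< (f (suc x)) (grow x 1≤x bound))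

  pairSum-< : ∀ {i j} → 1 ≤ i → i < j → suc j ≤ hi → pairSum i < pairSum j
  pairSum-< {i} {suc j} 1≤i (s≤s i≤j) bound with m≤n⇒m<n∨m≡n i≤j
  ... | inj₂ refl = pairSum-step i 1≤i bound
  ... | inj₁ i<j  = <-trans (pairSum-< 1≤i i<j (≤-trans (n≤1+n _) bound))
                            (pairSum-step j (≤-trans 1≤i (<⇒≤ i<j)) bound)

  pairSum-≤ : ∀ {i j} → 1 ≤ i → i ≤ j → suc j ≤ hi → pairSum i ≤ pairSum j
  pairSum-≤ 1≤i i≤j bound with m≤n⇒m<n∨m≡n i≤j
  ... | inj₁ i<j  = <⇒≤ (pairSum-< 1≤i i<j bound)
  ... | inj₂ refl = ≤-refl

module Labeling (C : Caterpillar) where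
  open Caterpillar C

  -- Edge labels, leg labels and light vertices after stage n, i.e. after
  -- e_1, …, e_{n+2} have been labelled; stage N is the final labeling.
  E : ℕ → ℕ → ℕ
  E n = LState.eLab (run C n)

  F : ℕ → ℕ → ℕ
  F n = LState.fLab (run C n)

  L : ℕ → List ℕ
  L n = LState.light (run C n)

  N : ℕ
  N = p ∸ 2

  p≡2+N : p ≡ 2 + N
  p≡2+N = sym (trans (+-comm 2 N) (m∸n+n≡m 2≤p))

  lightTest : (ℕ → ℕ) → ℕ → ℕ → Bool
  lightTest e i k = deg3 C k ∧ (e (i ∸ 1) ≡ᵇ e k + e (suc k))

  data StepView (i : ℕ) (e f : ℕ → ℕ) (U : List ℕ) : LState → Set where
    extend  : StepView i e f U (mkState (upd e i (e (i ∸ 2) + 1)) f U)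
    lighten : ∀ k → i % 2 ≡ p % 2 → search (lightTest e i) 1 (i ∸ 3) ≡ just k →
              StepView i e f U (mkState (upd e i (e (i ∸ 2) + 2)) (upd f k (e (i ∸ 2) + 1)) (k ∷ U))

  stepView : ∀ i e f U → StepView i e f U (step C i (mkState e f U))
  stepView i e f U with i % 2 ≟ p % 2
  ... | no _ = extend
  ... | yes same with search (λ k → deg3 C k ∧ (e (i ∸ 1) ≡ᵇ e k + e (suc k))) 1 (i ∸ 3) in found
  ...   | nothing = extend
  ...   | just k  = lighten k same found

  view : ∀ n → StepView (3 + n) (E n) (F n) (L n) (run C (suc n))
  view n rewrite +-comm n 3 = stepView (3 + n) (E n) (F n) (L n)

  view-stable : ∀ {i e f U s} → StepView i e f U s → ∀ j → ¬ (j ≡ i) → LState.eLab s j ≡ e j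
  view-stable {i} {e} extend j j≢i = upd-other e i _ j j≢i
  view-stable {i} {e} (lighten _ _ _) j j≢i = upd-other e i _ j j≢i

  view-growth : ∀ {i e f U s} → StepView i e f U s →
    ∃[ b ] (LState.eLab s i ≡ suc (e (i ∸ 2) + b)) × (length (LState.light s) ≡ b + length U)
  view-growth {i} {e} extend =
    0 , trans (upd-same e i _) (+-suc (e (i ∸ 2)) 0) , refl
  view-growth {i} {e} (lighten _ _ _) =
    1 , trans (upd-same e i _) (+-suc (e (i ∸ 2)) 1) , refl

  view-light : ∀ {i e f U s} → StepView i e f U s → ∀ {k} → k ∈ LState.light s →
      (k ∈ U × LState.fLab s k ≡ f k)
    ⊎ (i % 2 ≡ p % 2 × search (lightTest e i) 1 (i ∸ 3) ≡ just k × LState.fLab s k ≡ e (i ∸ 2) + 1)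
  view-light extend k∈ = inj₁ (k∈ , refl)
  view-light {f = f} (lighten k′ same found) {k} k∈ with k ≟ k′ | k∈
  ... | yes refl | _         = inj₂ (same , found , upd-same f k _)
  ... | no k≢k′  | here k≡k′ = ⊥-elim (k≢k′ k≡k′)
  ... | no k≢k′  | there k∈U = inj₁ (k∈U , upd-other f k′ _ k k≢k′)

  stable-step : ∀ n j → j ≤ 2 + n → E (suc n) j ≡ E n j
  stable-step n j j≤ = view-stable (view n) j (<⇒≢ (s≤s j≤))

  stable : ∀ n d j → j ≤ 2 + n → E (d + n) j ≡ E n j
  stable n zero j j≤ = refl
  stable n (suc d) j j≤ = trans (stable-step (d + n) j (≤-trans j≤ (+-monoʳ-≤ 2 (m≤n+m n d)))) (stable n d j j≤)

  Ef : ℕ → ℕ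
  Ef = φe C

  final-agrees : ∀ n j → n ≤ N → j ≤ 2 + n → Ef j ≡ E n j
  final-agrees n j n≤N j≤ = trans (cong (λ s → E s j) (sym (m∸n+n≡m n≤N))) (stable n (N ∸ n) j j≤)

  Ef-grow : ∀ x → 1 ≤ x → 2 + x ≤ p → Ef x < Ef (2 + x)
  Ef-grow (suc n) _ bound with view-growth (view n)
  ... | b , new , _ = begin-strict
      Ef (suc n)          ≡⟨ final-agrees n (suc n) (≤-trans (n≤1+n n) n<N) (n≤1+n _) ⟩
      E n (suc n)         <⟨ s≤s (m≤m+n _ b) ⟩
      suc (E n (suc n) + b) ≡⟨ sym new ⟩
      E (suc n) (3 + n)   ≡⟨ sym (final-agrees (suc n) (3 + n) n<N ≤-refl) ⟩
      Ef (3 + n)          ∎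
    where
    open ≤-Reasoning
    n<N : suc n ≤ N
    n<N = ≤-pred (≤-pred (subst (3 + n ≤_) p≡2+N bound))

  open StrideTwo Ef p Ef-grow public

  a : ℕ
  a = m C ∸ ⌊ p /2⌋

  L0≡[] : L 0 ≡ []
  L0≡[] with p % 2 ≟ 1
  ... | yes _ = refl
  ... | no  _ = refl

  newest-pairSum : ∀ n → E n (1 + n) + E n (2 + n) ≡ a + (2 + n) + length (L n)
  newest-pairSum zero with p % 2 ≟ 1
  ... | yes _ = odd-start a
    where
    odd-start : ∀ a → 1 + (a + 1) ≡ a + 2 + 0
    odd-start = solve-∀
  ... | no  _ = even-start a
    where
    even-start : ∀ a → a + 1 + 1 ≡ a + 2 + 0
    even-start = solve-∀
  newest-pairSum (suc n) with view-growth (view n)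
  ... | b , new , len = begin
      E (suc n) (2 + n) + E (suc n) (3 + n)  ≡⟨ cong₂ _+_ (stable-step n (2 + n) ≤-refl) new ⟩
      E n (2 + n) + suc (E n (1 + n) + b)    ≡⟨ regroup (E n (1 + n)) (E n (2 + n)) b ⟩
      suc (E n (1 + n) + E n (2 + n) + b)    ≡⟨ cong (λ s → suc (s + b)) (newest-pairSum n) ⟩
      suc (a + (2 + n) + length (L n) + b)   ≡⟨ shift a n (length (L n)) b ⟩
      a + (3 + n) + (b + length (L n))       ≡⟨ cong (a + (3 + n) +_) (sym len) ⟩
      a + (3 + n) + length (L (suc n))       ∎
    where
    open ≡-Reasoning
    regroup : ∀ x y b → y + suc (x + b) ≡ suc (x + y + b)
    regroup = solve-∀
    shift : ∀ a n l b → suc (a + (2 + n) + l + b) ≡ a + (3 + n) + (b + l)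
    shift = solve-∀

  first-pairSum : pairSum 1 ≡ a + 2
  first-pairSum = begin
      Ef 1 + Ef 2                ≡⟨ cong₂ _+_ (final-agrees 0 1 z≤n (s≤s z≤n)) (final-agrees 0 2 z≤n ≤-refl) ⟩
      E 0 1 + E 0 2              ≡⟨ newest-pairSum 0 ⟩
      a + 2 + length (L 0)       ≡⟨ cong (λ l → a + 2 + length l) L0≡[] ⟩
      a + 2 + 0                  ≡⟨ +-identityʳ _ ⟩
      a + 2                      ∎
    where open ≡-Reasoning

  last-pairSum : pairSum (suc N) ≡ m C + ⌈ p /2⌉ + length (Up C)
  last-pairSum = begin
      E N (1 + N) + E N (2 + N)                 ≡⟨ newest-pairSum N ⟩
      a + (2 + N) + length (L N)                ≡⟨ cong (λ q → a + q + length (L N)) (sym p≡2+N) ⟩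
      a + p + length (L N)                      ≡⟨ cong (λ q → a + q + length (L N)) (sym (⌊n/2⌋+⌈n/2⌉≡n p)) ⟩
      a + (⌊ p /2⌋ + ⌈ p /2⌉) + length (L N)    ≡⟨ cong (_+ length (L N)) (sym (+-assoc a _ _)) ⟩
      a + ⌊ p /2⌋ + ⌈ p /2⌉ + length (L N)      ≡⟨ cong (λ q → q + ⌈ p /2⌉ + length (L N)) (m∸n+n≡m ⌊p/2⌋≤m) ⟩
      m C + ⌈ p /2⌉ + length (L N)              ∎
    where
    open ≡-Reasoning
    ⌊p/2⌋≤m : ⌊ p /2⌋ ≤ m C
    ⌊p/2⌋≤m = ≤-trans (⌊n/2⌋≤n p) (m≤m+n p _)

  pairSum-lower : ∀ {i} → 1 ≤ i → i < p → a + 2 ≤ pairSum i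
  pairSum-lower 1≤i i<p = ≤-trans (≤-reflexive (sym first-pairSum)) (pairSum-≤ ≤-refl 1≤i i<p)

  pairSum-upper : ∀ {i} → 1 ≤ i → i < p → pairSum i ≤ m C + ⌈ p /2⌉ + length (Up C)
  pairSum-upper 1≤i i<p =
    ≤-trans (pairSum-≤ 1≤i (≤-pred (≤-trans i<p (≤-reflexive p≡2+N))) (≤-reflexive (sym p≡2+N)))
            (≤-reflexive last-pairSum)

  record LightWitness (n k : ℕ) : Set where
    field
      u      : ℕ        -- v_k became light at the step labelling e_{u+3}
      1≤k    : 1 ≤ k
      k≤u    : k ≤ u
      u<n    : u < n
      parity : (3 + u) % 2 ≡ p % 2
      sum    : E n (2 + u) ≡ E n k + E n (suc k)
      leg    : F n k ≡ E n (1 + u) + 1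

  carry : ∀ {n k} → LightWitness n k → F (suc n) k ≡ F n k → LightWitness (suc n) k
  carry {n} {k} w leg-kept = record
    { u = u ; 1≤k = 1≤k ; k≤u = k≤u ; u<n = ≤-trans u<n (n≤1+n n) ; parity = parity
    ; sum = trans (old ≤-refl) (trans sum (sym (cong₂ _+_ (old k≤2+u) (old (s≤s k≤1+u)))))
    ; leg = trans leg-kept (trans leg (cong (_+ 1) (sym (old (n≤1+n _))))) }
    where
    open LightWitness w
    old : ∀ {j} → j ≤ 2 + u → E (suc n) j ≡ E n j
    old j≤ = stable-step n _ (≤-trans j≤ (+-monoʳ-≤ 2 (<⇒≤ u<n)))
    k≤1+u : k ≤ 1 + u
    k≤1+u = ≤-trans k≤u (n≤1+n u)
    k≤2+u : k ≤ 2 + u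
    k≤2+u = ≤-trans k≤1+u (n≤1+n _)

  fresh : ∀ {n k} → (3 + n) % 2 ≡ p % 2 → search (lightTest (E n) (3 + n)) 1 n ≡ just k →
          F (suc n) k ≡ E n (1 + n) + 1 → LightWitness (suc n) k
  fresh {n} {k} same found leg-new = record
    { u = n ; 1≤k = 1≤k ; k≤u = ≤-pred k<1+n ; u<n = ≤-refl ; parity = same
    ; sum = trans (old ≤-refl) (trans sum-old (sym (cong₂ _+_ (old (≤-trans (<⇒≤ k<1+n) (n≤1+n _))) (old (≤-trans k<1+n (n≤1+n _))))))
    ; leg = trans leg-new (cong (_+ 1) (sym (old (n≤1+n _)))) }
    where
    sound : T (lightTest (E n) (3 + n) k) × 1 ≤ k × k < 1 + n
    sound = search-sound (lightTest (E n) (3 + n)) 1 n found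
    1≤k : 1 ≤ k
    1≤k = proj₁ (proj₂ sound)
    k<1+n : k < 1 + n
    k<1+n = proj₂ (proj₂ sound)
    sum-old : E n (2 + n) ≡ E n k + E n (suc k)
    sum-old = ≡ᵇ⇒≡ _ _ (proj₂ (Equivalence.to T-∧ (proj₁ sound)))
    old : ∀ {j} → j ≤ 2 + n → E (suc n) j ≡ E n j
    old = stable-step n _

  light-witness : ∀ n k → k ∈ L n → LightWitness n k
  light-witness zero k k∈ with () ← subst (k ∈_) L0≡[] k∈
  light-witness (suc n) k k∈ with view-light (view n) k∈
  ... | inj₁ (k∈L , leg-kept)     = carry (light-witness n k k∈L) leg-kept
  ... | inj₂ (same , found , leg) = fresh same found leg

  step-within : ∀ {u} → u < N → 3 + u ≤ p
  step-within u<N = subst (3 + _ ≤_) (sym p≡2+N) (s≤s (s≤s u<N))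

  light-order : ∀ {i j} → i ∈ Up C → j ∈ Up C → i < j → φf C i < φf C j
  light-order {i} {j} i∈ j∈ i<j = by-steps (Wj.u ≤? Wi.u)
    where
    module Wi = LightWitness (light-witness N i i∈)
    module Wj = LightWitness (light-witness N j j∈)
    same : (1 + Wi.u) % 2 ≡ (1 + Wj.u) % 2
    same = trans Wi.parity (sym Wj.parity)
    by-steps : Dec (Wj.u ≤ Wi.u) → φf C i < φf C j
    -- v_j made light no later than v_i would force S(j) ≤ S(i).
    by-steps (yes uj≤ui) with parity-gap (1 + Wj.u) (1 + Wi.u) (sym same) (s≤s uj≤ui)
    ... | d , gap = ⊥-elim (<⇒≱ (pairSum-< Wi.1≤k i<j j<p) sums)
      where
      j<p : suc j ≤ p
      j<p = ≤-trans (s≤s Wj.k≤u) (≤-trans (m≤n+m _ 2) (step-within Wj.u<n))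
      sums : pairSum j ≤ pairSum i
      sums = subst₂ _≤_ Wj.sum Wi.sum
               (gap-≤ {d = d} (s≤s z≤n) (cong suc gap) (≤-trans (n≤1+n (2 + Wi.u)) (step-within Wi.u<n)))
    -- v_i made light strictly earlier: its leg label is strictly smaller.
    by-steps (no uj≰ui) with parity-gap-< (1 + Wi.u) (1 + Wj.u) same (s≤s (≰⇒> uj≰ui))
    ... | d , gap = subst₂ _<_ (sym Wi.leg) (sym Wj.leg)
                      (+-monoˡ-< 1 (gap-< {d = d} (s≤s z≤n) gap (≤-trans (m≤n+m _ 2) (step-within Wj.u<n))))

lemma2 : (C : Caterpillar) → (i j : ℕ) → 1 ≤ i → i ≤ j → j < Caterpillar.p C →
    ((m C ∸ ⌊ Caterpillar.p C /2⌋ + 2 ≤ φe C i + φe C (i + 1))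
      × (φe C i + φe C (i + 1) ≤ m C + ⌈ Caterpillar.p C /2⌉ + length (Up C)))
    × (i < j → φe C i + φe C (i + 1) < φe C j + φe C (j + 1))
    × (i ∈ Up C → j ∈ Up C → i < j → φf C i < φf C j)
lemma2 C i j 1≤i i≤j j<p rewrite +-comm i 1 | +-comm j 1 =
    (pairSum-lower 1≤i i<p , pairSum-upper 1≤i i<p)
  , (λ i<j → pairSum-< 1≤i i<j j<p)
  , light-order
  where
  open Labeling C
  i<p : i < Caterpillar.p C
  i<p = ≤-<-trans i≤j j<p
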